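{- Let $(S,=,\#)$ be a set with apartness and let $\tau$ be a co-quasiorder on $S$. Then: (i) $\tau$ is a qd-subset of $S\times S$; (ii) ${\sim}\tau=\neg\tau$; (iii) ${\sim}\tau$ (equivalently $\neg\tau$) is a quasiorder (reflexive and transitive relation) on $S$.
   Context: Constructive (Bishop-style, intuitionistic) setting. A set with apartness $(S,=,\#)$: inhabited set with equality $=$ (an equivalence) and relation $\#$ with $\neg(x\#x)$, $x\#y\Rightarrow y\#x$, $x\#z\Rightarrow\forall y(x\#y\vee y\#z)$, extensional w.r.t. $=$. $S\times S$ has apartness $(s,t)\#(u,v)\iff s\#u\vee t\#v$. A relation on $S$ is a subset $\alpha\subseteq S\times S$; $\neg\alpha=\{(x,y):(x,y)\notin\alpha\}$, ${\sim}\alpha=\{(x,y):\forall (a,b)\in\alpha\,((x,y)\#(a,b))\}$. A subset $Y$ of a set with apartness $X$ is a qd-subset if $\forall x\in X\,\forall y\in Y\,(x\in Y\vee x\#y)$. $\alpha$ is strongly irreflexive if $(x,y)\in\alpha\Rightarrow x\#y$; co-transitive if $(x,y)\in\alpha\Rightarrow\forall z\in S\,((x,z)\in\alpha\vee(z,y)\in\alpha)$. A co-quasiorder is a strongly irreflexive co-transitive relation. -}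

module Defs where

open import Level using (Level; _⊔_; suc)
open import Data.Product using (_×_; _,_; ∃)
open import Data.Sum using (_⊎_)
open import Relation.Nullary using (¬_)
open import Relation.Binary.Structures using (IsEquivalence)

record SetWithApartness (c ℓ₁ ℓ₂ : Level) : Set (suc (c ⊔ ℓ₁ ⊔ ℓ₂)) where
  infix 4 _≈_ _#_
  field
    Carrier   : Set c
    _≈_       : Carrier → Carrier → Set ℓ₁
    _#_       : Carrier → Carrier → Set ℓ₂
    inhabited : Carrier
    isEquiv   : IsEquivalence _≈_
    #-irrefl  : ∀ x → ¬ (x # x)
    #-sym     : ∀ {x y} → x # y → y # x
    #-cotrans : ∀ {x z} → x # z → ∀ y → (x # y) ⊎ (y # z)
    #-ext     : ∀ {x x′ y y′} → x ≈ x′ → y ≈ y′ → x # y → x′ # y′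

module _ {c ℓ₁ ℓ₂ : Level} (S : SetWithApartness c ℓ₁ ℓ₂) where
  open SetWithApartness S

  Relation : (ℓ : Level) → Set (c ⊔ suc ℓ)
  Relation ℓ = Carrier → Carrier → Set ℓ

  IsExtensional : ∀ {ℓ} → Relation ℓ → Set (c ⊔ ℓ₁ ⊔ ℓ)
  IsExtensional α = ∀ {x x′ y y′} → x ≈ x′ → y ≈ y′ → α x y → α x′ y′

  _#²_ : (Carrier × Carrier) → (Carrier × Carrier) → Set ℓ₂
  (s , t) #² (u , v) = (s # u) ⊎ (t # v)

  neg : ∀ {ℓ} → Relation ℓ → Relation ℓ
  neg α x y = ¬ α x y

  compl : ∀ {ℓ} → Relation ℓ → Relation (c ⊔ ℓ₂ ⊔ ℓ)
  compl α x y = ∀ a b → α a b → (x , y) #² (a , b)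

  IsQdSubset : ∀ {ℓ} → Relation ℓ → Set (c ⊔ ℓ₂ ⊔ ℓ)
  IsQdSubset α = ∀ x y a b → α a b → α x y ⊎ ((x , y) #² (a , b))

  _≐_ : ∀ {ℓ ℓ′} → Relation ℓ → Relation ℓ′ → Set (c ⊔ ℓ ⊔ ℓ′)
  α ≐ β = (∀ x y → α x y → β x y) × (∀ x y → β x y → α x y)

  StronglyIrreflexive : ∀ {ℓ} → Relation ℓ → Set (c ⊔ ℓ₂ ⊔ ℓ)
  StronglyIrreflexive α = ∀ {x y} → α x y → x # y

  CoTransitive : ∀ {ℓ} → Relation ℓ → Set (c ⊔ ℓ)
  CoTransitive α = ∀ {x y} → α x y → ∀ z → α x z ⊎ α z y

  record IsCoQuasiorder {ℓ} (τ : Relation ℓ) : Set (c ⊔ ℓ₁ ⊔ ℓ₂ ⊔ ℓ) where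
    field
      ext      : IsExtensional τ
      s-irrefl : StronglyIrreflexive τ
      cotrans  : CoTransitive τ

  record IsQuasiorder {ℓ} (α : Relation ℓ) : Set (c ⊔ ℓ) where
    field
      refl  : ∀ x → α x x
      trans : ∀ {x y z} → α x y → α y z → α x z

{-# OPTIONS --safe #-}
module Submission where

open import Defs
open import Level using (Level)
open import Data.Product using (_×_; _,_)
open import Data.Sum using (_⊎_; inj₁; inj₂; [_,_])
open import Data.Empty using (⊥-elim)

-- Co-transitivity at x and then at y splits τ a b into τ a x, τ x y or τ y b;
-- strong irreflexivity turns the outer two cases into a # x and y # b.
-- Since # is irreflexive, ∼α ⊆ ¬α holds for every α, and ¬α ⊆ ∼α for every
-- qd-subset; so ∼τ = ¬τ, and ¬τ is a quasiorder by the contrapositives of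
-- the two defining properties of τ.

module _ {c ℓ₁ ℓ₂ : Level} (S : SetWithApartness c ℓ₁ ℓ₂) where
  open SetWithApartness S

  coQuasiorder⇒qdSubset : ∀ {ℓ} {τ : Relation S ℓ} →
    StronglyIrreflexive S τ → CoTransitive S τ → IsQdSubset S τ
  coQuasiorder⇒qdSubset irr cot x y a b τab with cot τab x
  ... | inj₁ τax = inj₂ (inj₁ (#-sym (irr τax)))
  ... | inj₂ τxb with cot τxb y
  ...   | inj₁ τxy = inj₁ τxy
  ...   | inj₂ τyb = inj₂ (inj₂ (irr τyb))

  compl⊆neg : ∀ {ℓ} (α : Relation S ℓ) x y → compl S α x y → neg S α x y
  compl⊆neg α x y x∼y αxy = [ #-irrefl x , #-irrefl y ] (x∼y x y αxy)

  qdSubset⇒neg⊆compl : ∀ {ℓ} {α : Relation S ℓ} →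
    IsQdSubset S α → ∀ x y → neg S α x y → compl S α x y
  qdSubset⇒neg⊆compl qd x y ¬αxy a b αab =
    [ (λ αxy → ⊥-elim (¬αxy αxy)) , (λ apart → apart) ] (qd x y a b αab)

  stronglyIrreflexive⇒neg-refl : ∀ {ℓ} {α : Relation S ℓ} →
    StronglyIrreflexive S α → ∀ x → neg S α x x
  stronglyIrreflexive⇒neg-refl irr x αxx = #-irrefl x (irr αxx)

  coTransitive⇒neg-trans : ∀ {ℓ} {α : Relation S ℓ} → CoTransitive S α →
    ∀ {x y z} → neg S α x y → neg S α y z → neg S α x z
  coTransitive⇒neg-trans cot {y = y} ¬αxy ¬αyz αxz = [ ¬αxy , ¬αyz ] (cot αxz y)

  isQuasiorder-resp-≐ : ∀ {ℓ ℓ′} {α : Relation S ℓ} {β : Relation S ℓ′} →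
    _≐_ S α β → IsQuasiorder S α → IsQuasiorder S β
  isQuasiorder-resp-≐ (α⊆β , β⊆α) q = record
    { refl  = λ x → α⊆β x x (refl x)
    ; trans = λ {x} {y} {z} βxy βyz → α⊆β x z (trans (β⊆α x y βxy) (β⊆α y z βyz))
    }
    where open IsQuasiorder q

proposition2 : {c ℓ₁ ℓ₂ ℓ : Level} (S : SetWithApartness c ℓ₁ ℓ₂)
               (τ : Relation S ℓ) → IsCoQuasiorder S τ →
               IsQdSubset S τ
               × (_≐_ S (compl S τ) (neg S τ))
               × IsQuasiorder S (compl S τ)
               × IsQuasiorder S (neg S τ)
proposition2 S τ cq = qd , compl≐neg , isQuasiorder-resp-≐ S neg≐compl negQuasi , negQuasi
  where
  open IsCoQuasiorder cq
  qd : IsQdSubset S τ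
  qd = coQuasiorder⇒qdSubset S s-irrefl cotrans
  compl≐neg : _≐_ S (compl S τ) (neg S τ)
  compl≐neg = compl⊆neg S τ , qdSubset⇒neg⊆compl S qd
  neg≐compl : _≐_ S (neg S τ) (compl S τ)
  neg≐compl = qdSubset⇒neg⊆compl S qd , compl⊆neg S τ
  negQuasi : IsQuasiorder S (neg S τ)
  negQuasi = record
    { refl  = stronglyIrreflexive⇒neg-refl S s-irrefl
    ; trans = coTransitive⇒neg-trans S cotrans
    }
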